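{- There are infinitely many distinct logics $\mathcal{L}$ with $\mathrm{FL}+(\mathrm{Vi})+(\mathrm{Nu})\subseteq\mathcal{L}\subseteq\mathrm{FL}+(\mathrm{Ex})$.
   Context: Formulas use variables, $\top,\bot,\wedge,\vee,\lnot$. A fundamental lattice is a bounded lattice with unary $\lnot$ that is antitone, satisfies $a\wedge\lnot a=0$ and $a\le\lnot\lnot a$; an entailment is valid in $L$ if it holds under all valuations into $L$. For a set $\Gamma$ of entailments, $\mathrm{FL}+\Gamma$ is the set of entailments valid in every fundamental lattice validating $\Gamma$; "logics" here are sets of this form. Axioms: (Nu) $\lnot\lnot p\wedge\lnot\lnot q\vdash\lnot\lnot(p\wedge q)$; (Vi) $a\wedge(c\vee e)\wedge\lnot\lnot f\vdash(a\wedge c)\vee(a\wedge e)\vee f$; (Ex) $\lnot[a\wedge((b\wedge c)\vee(b\wedge d))]\wedge a\wedge(c\vee e)\wedge\lnot\lnot f\vdash\lnot\lnot(a\wedge f)\wedge[(a\wedge c)\vee(a\wedge e)\vee f]\wedge[(b\wedge(c\vee d))\vee\lnot(b\wedge(c\vee d))]$. -}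

module Defs where

open import Level using (0ℓ) renaming (suc to lsuc)
open import Data.Nat using (ℕ)
open import Data.Product using (_×_; _,_)
open import Relation.Binary.Lattice.Bundles using (BoundedLattice)

data Fm : Set where
  var  : ℕ → Fm
  ⊤f   : Fm
  ⊥f   : Fm
  _∧f_ : Fm → Fm → Fm
  _∨f_ : Fm → Fm → Fm
  ¬f_  : Fm → Fm

infixr 7 _∧f_
infixr 6 _∨f_
infix  8 ¬f_

record Entailment : Set where
  constructor _⊢_
  field
    lhs : Fm
    rhs : Fm

infix 4 _⊢_

record FundLattice : Set₁ where
  field
    lat : BoundedLattice 0ℓ 0ℓ 0ℓ
  open BoundedLattice lat public
  field
    ¬_       : Carrier → Carrier
    antitone : ∀ {a b} → a ≤ b → ¬ b ≤ ¬ a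
    contra   : ∀ a → (a ∧ (¬ a)) ≈ ⊥
    dneg     : ∀ a → a ≤ ¬ (¬ a)

module _ (L : FundLattice) where
  open FundLattice L

  ⟦_⟧ : Fm → (ℕ → Carrier) → Carrier
  ⟦ var n ⟧ v = v n
  ⟦ ⊤f ⟧ v = ⊤
  ⟦ ⊥f ⟧ v = ⊥
  ⟦ φ ∧f ψ ⟧ v = ⟦ φ ⟧ v ∧ ⟦ ψ ⟧ v
  ⟦ φ ∨f ψ ⟧ v = ⟦ φ ⟧ v ∨ ⟦ ψ ⟧ v
  ⟦ ¬f φ ⟧ v = ¬ (⟦ φ ⟧ v)

  Valid : Entailment → Set
  Valid (φ ⊢ ψ) = ∀ (v : ℕ → Carrier) → ⟦ φ ⟧ v ≤ ⟦ ψ ⟧ v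

EntSet : Set₁
EntSet = Entailment → Set

FL+ : (Entailment → Set) → Entailment → Set₁
FL+ Γ e = ∀ (L : FundLattice) → (∀ g → Γ g → Valid L g) → Valid L e

_⊆E_ : ∀ {a b} → (Entailment → Set a) → (Entailment → Set b) → Set _
A ⊆E B = ∀ e → A e → B e

_≐E_ : ∀ {a b} → (Entailment → Set a) → (Entailment → Set b) → Set _
A ≐E B = (A ⊆E B) × (B ⊆E A)

Nu : Entailment
Nu = ¬f ¬f var 0 ∧f ¬f ¬f var 1 ⊢ ¬f ¬f (var 0 ∧f var 1)

module Vars where
  a b c d e f : Fm
  a = var 0
  b = var 1
  c = var 2
  d = var 3
  e = var 4
  f = var 5
open Vars

Vi : Entailment
Vi = a ∧f (c ∨f e) ∧f ¬f ¬f f ⊢ (a ∧f c) ∨f (a ∧f e) ∨f f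

Ex : Entailment
Ex = ¬f (a ∧f ((b ∧f c) ∨f (b ∧f d))) ∧f a ∧f (c ∨f e) ∧f ¬f ¬f f
   ⊢ ¬f ¬f (a ∧f f) ∧f ((a ∧f c) ∨f (a ∧f e) ∨f f)
       ∧f ((b ∧f (c ∨f d)) ∨f ¬f (b ∧f (c ∨f d)))

data ViNu : Entailment → Set where
  vi : ViNu Vi
  nu : ViNu Nu

data ExAx : Entailment → Set where
  ex : ExAx Ex

-- (Ex) with b := ⊥ yields (Vi) and, instantiated further, x ∧ ¬¬y ≤ ¬¬(x ∧ y), hence (Nu);
-- so (Vi), (Nu) and any weakening of (Ex) axiomatise a logic between the two bounds. The
-- weakenings used add to the conclusion of (Ex) a pigeonhole formula php N in fresh variables
-- p₀ … p_{N-1}. In the lattice 𝕂 P (⊥, then P pairs of atoms swapped by ¬, then mid, then ⊤)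
-- (Vi) and (Nu) hold, an atom b refutes the conjunct b ∨ ¬b of (Ex), and php N is ⊤ exactly
-- when N > P, as then some pᵢ is not an atom or two pᵢ share a pair. Hence 𝕂 (2 + n)
-- validates Ex-php (3 + n) but not Ex-php (3 + j) for j < n, which separates the logics.
module Submission where

open import Defs
open import Data.Nat using (ℕ)
open import Data.Product using (Σ; _×_)
open import Relation.Binary.PropositionalEquality using (_≢_)
open import Relation.Nullary using (¬_)

open import Level using (0ℓ)
open import Data.Nat using (zero; suc; _+_; s≤s)
import Data.Nat as ℕ
open import Data.Nat.Properties
  using (n<1+n; m<n⇒m<1+n; m<1+n⇒m<n∨m≡n; <-≤-trans; <-trans; <⇒≢; <-cmp)
open import Data.Nat.DivMod using (_mod_; _%_; m<n⇒m%n≡m)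
open import Data.Fin using (Fin; toℕ)
import Data.Fin as Fin
open import Data.Fin.Properties using (toℕ<n; pigeonhole; all?; ¬∀⟶∃¬; toℕ-fromℕ<)
open import Data.Bool using (Bool; true; false; not)
import Data.Bool.Properties as Bool
open import Data.Sum using (_⊎_; inj₁; inj₂)
open import Data.Product using (_,_; proj₁; proj₂; map₂)
open import Data.Product.Properties using (≡-dec)
open import Data.Empty using (⊥-elim)
open import Relation.Nullary using (Dec; yes; no)
open import Relation.Binary.Definitions using (DecidableEquality; tri<; tri≈; tri>)
open import Relation.Binary.PropositionalEquality
  using (_≡_; refl; cong; ≢-sym; isEquivalence; module ≡-Reasoning)
import Relation.Binary.PropositionalEquality as ≡
open import Relation.Binary.Lattice.Bundles using (BoundedLattice)

FL+-axiom : ∀ {Γ : EntSet} {e} → Γ e → FL+ Γ e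
FL+-axiom γ L ⊨Γ = ⊨Γ _ γ

FL+-⊆ : ∀ {Γ Δ : EntSet} → (∀ g → Γ g → FL+ Δ g) → FL+ Γ ⊆E FL+ Δ
FL+-⊆ Γ⊆Δ e ⊢e L ⊨Δ = ⊢e L λ g γ → Γ⊆Δ g γ L ⊨Δ

⋁< : ℕ → (ℕ → Fm) → Fm
⋁< zero    φ = ⊥f
⋁< (suc n) φ = φ n ∨f ⋁< n φ

wem : Fm → Fm
wem φ = ¬f φ ∨f ¬f ¬f φ

paired : Fm → Fm → Fm
paired φ ψ = ¬f ((φ ∨f ¬f ψ) ∧f (¬f φ ∧f (φ ∨f ψ)))

pigeon : ℕ → Fm
pigeon i = var (6 + i)

php : ℕ → Fm
php N = ⋁< N λ i → wem (pigeon i) ∨f ⋁< i λ l → paired (pigeon i) (pigeon l)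

Ex-php : ℕ → Entailment
Ex-php N = Entailment.lhs Ex ⊢ Entailment.rhs Ex ∨f php N

assign : {C : Set} (a b c d e f : C) → (ℕ → C) → ℕ → C
assign a b c d e f pigeons 0 = a
assign a b c d e f pigeons 1 = b
assign a b c d e f pigeons 2 = c
assign a b c d e f pigeons 3 = d
assign a b c d e f pigeons 4 = e
assign a b c d e f pigeons 5 = f
assign a b c d e f pigeons (suc (suc (suc (suc (suc (suc i)))))) = pigeons i

module _ (L : FundLattice) where
  open FundLattice L renaming (¬_ to ~_; refl to ≤-refl)
  open import Relation.Binary.Reasoning.PartialOrder poset

  private
    ⟦_⟧ᴸ : Fm → (ℕ → Carrier) → Carrier
    ⟦_⟧ᴸ = ⟦_⟧ L

  ⊤≤~ : ∀ {x} → x ≤ ⊥ → ⊤ ≤ ~ x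
  ⊤≤~ x≤⊥ = trans (dneg ⊤) (antitone (trans x≤⊥ (minimum _)))

  ~~-mono : ∀ {x y} → x ≤ y → ~ ~ x ≤ ~ ~ y
  ~~-mono x≤y = antitone (antitone x≤y)

  ~~~~≤~~ : ∀ x → ~ ~ ~ ~ x ≤ ~ ~ x
  ~~~~≤~~ x = antitone (dneg (~ x))

  ∧-swap : ∀ x y → x ∧ y ≤ y ∧ x
  ∧-swap x y = ∧-greatest (x∧y≤y x y) (x∧y≤x x y)

  Ex[b≔⊥] : Valid L Ex → ∀ a c e f →
            a ∧ (c ∨ e) ∧ ~ ~ f ≤ ~ ~ (a ∧ f) ∧ ((a ∧ c) ∨ (a ∧ e) ∨ f)
  Ex[b≔⊥] ⊨Ex a c e f =
    trans (∧-greatest (trans (maximum _) (⊤≤~ b-part≤⊥)) ≤-refl)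
          (trans (⊨Ex (assign a ⊥ c ⊥ e f λ _ → ⊥))
                 (∧-greatest (x∧y≤x _ _) (trans (x∧y≤y _ _) (x∧y≤x _ _))))
    where
    b-part≤⊥ : a ∧ ((⊥ ∧ c) ∨ (⊥ ∧ ⊥)) ≤ ⊥
    b-part≤⊥ = trans (x∧y≤y _ _) (∨-least (x∧y≤x _ _) (x∧y≤x _ _))

  Ex⇒Vi : Valid L Ex → Valid L Vi
  Ex⇒Vi ⊨Ex v = trans (Ex[b≔⊥] ⊨Ex (v 0) (v 2) (v 4) (v 5)) (x∧y≤y _ _)

  Ex⇒∧~~≤~~∧ : Valid L Ex → ∀ x y → x ∧ ~ ~ y ≤ ~ ~ (x ∧ y)
  Ex⇒∧~~≤~~∧ ⊨Ex x y =
    trans (∧-greatest (x∧y≤x _ _) (∧-greatest (trans (maximum _) (x≤x∨y ⊤ ⊤)) (x∧y≤y _ _)))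
          (trans (Ex[b≔⊥] ⊨Ex x ⊤ ⊤ y) (x∧y≤x _ _))

  Ex⇒Nu : Valid L Ex → Valid L Nu
  Ex⇒Nu ⊨Ex v = begin
    ~ ~ p ∧ ~ ~ q    ≤⟨ Ex⇒∧~~≤~~∧ ⊨Ex (~ ~ p) q ⟩
    ~ ~ (~ ~ p ∧ q)  ≤⟨ ~~-mono (∧-swap (~ ~ p) q) ⟩
    ~ ~ (q ∧ ~ ~ p)  ≤⟨ ~~-mono (Ex⇒∧~~≤~~∧ ⊨Ex q p) ⟩
    ~ ~ ~ ~ (q ∧ p)  ≤⟨ ~~~~≤~~ (q ∧ p) ⟩
    ~ ~ (q ∧ p)      ≤⟨ ~~-mono (∧-swap q p) ⟩
    ~ ~ (p ∧ q)      ∎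
    where
    p = v 0
    q = v 1

  Ex⇒Ex-php : Valid L Ex → ∀ N → Valid L (Ex-php N)
  Ex⇒Ex-php ⊨Ex N v = trans (⊨Ex v) (x≤x∨y _ _)

  ⋁<-upper : ∀ {n i} (φ : ℕ → Fm) v → i ℕ.< n → ⟦ φ i ⟧ᴸ v ≤ ⟦ ⋁< n φ ⟧ᴸ v
  ⋁<-upper {suc n} φ v i<1+n with m<1+n⇒m<n∨m≡n i<1+n
  ... | inj₁ i<n  = trans (⋁<-upper φ v i<n) (y≤x∨y _ _)
  ... | inj₂ refl = x≤x∨y _ _

  ⋁<-least : ∀ {n z} (φ : ℕ → Fm) v → (∀ i → i ℕ.< n → ⟦ φ i ⟧ᴸ v ≤ z) → ⟦ ⋁< n φ ⟧ᴸ v ≤ z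
  ⋁<-least {zero}  φ v _ = minimum _
  ⋁<-least {suc n} φ v φ≤z =
    ∨-least (φ≤z n (n<1+n n)) (⋁<-least φ v λ i i<n → φ≤z i (m<n⇒m<1+n i<n))

  wem≤php : ∀ {i N} v → i ℕ.< N → ⟦ wem (pigeon i) ⟧ᴸ v ≤ ⟦ php N ⟧ᴸ v
  wem≤php v i<N = trans (x≤x∨y _ _) (⋁<-upper _ v i<N)

  paired≤php : ∀ {l i N} v → l ℕ.< i → i ℕ.< N →
               ⟦ paired (pigeon i) (pigeon l) ⟧ᴸ v ≤ ⟦ php N ⟧ᴸ v
  paired≤php v l<i i<N =
    trans (⋁<-upper _ v l<i) (trans (y≤x∨y _ _) (⋁<-upper _ v i<N))

  php-least : ∀ {N z} v →
              (∀ i → i ℕ.< N → ⟦ wem (pigeon i) ⟧ᴸ v ≤ z) →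
              (∀ i l → l ℕ.< i → i ℕ.< N → ⟦ paired (pigeon i) (pigeon l) ⟧ᴸ v ≤ z) →
              ⟦ php N ⟧ᴸ v ≤ z
  php-least v wem≤z paired≤z = ⋁<-least _ v λ i i<N →
    ∨-least (wem≤z i i<N) (⋁<-least _ v λ l l<i → paired≤z i l l<i i<N)

module AtomLattice {A : Set} (_≟_ : DecidableEquality A) (partner : A → A)
  (partner-involutive : ∀ a → partner (partner a) ≡ a) (partner-≢ : ∀ a → partner a ≢ a) where

  data K : Set where
    bot : K
    at  : A → K
    mid : K
    top : K

  infix 4 _≤_
  data _≤_ : K → K → Set where
    bot≤    : ∀ {x} → bot ≤ x
    ≤top    : ∀ {x} → x ≤ top
    at≤mid  : ∀ {a} → at a ≤ mid
    mid≤mid : mid ≤ mid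
    at≤at   : ∀ {a} → at a ≤ at a

  at-meet at-join : ∀ {a b : A} → Dec (a ≡ b) → K
  at-meet {a} (yes _) = at a
  at-meet     (no _)  = bot
  at-join {a} (yes _) = at a
  at-join     (no _)  = mid

  infixr 7 _∧_
  infixr 6 _∨_
  _∧_ _∨_ : K → K → K
  bot  ∧ _    = bot
  top  ∧ y    = y
  mid  ∧ bot  = bot
  mid  ∧ at b = at b
  mid  ∧ mid  = mid
  mid  ∧ top  = mid
  at a ∧ bot  = bot
  at a ∧ at b = at-meet (a ≟ b)
  at a ∧ mid  = at a
  at a ∧ top  = at a

  bot  ∨ y    = y
  top  ∨ _    = top
  mid  ∨ bot  = mid
  mid  ∨ at _ = mid
  mid  ∨ mid  = mid
  mid  ∨ top  = top
  at a ∨ bot  = at a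
  at a ∨ at b = at-join (a ≟ b)
  at a ∨ mid  = mid
  at a ∨ top  = top

  infix 8 ~_
  ~_ : K → K
  ~ bot  = top
  ~ at a = at (partner a)
  ~ mid  = bot
  ~ top  = bot

  ≤-refl : ∀ {x} → x ≤ x
  ≤-refl {bot}  = bot≤
  ≤-refl {at a} = at≤at
  ≤-refl {mid}  = mid≤mid
  ≤-refl {top}  = ≤top

  ≤-trans : ∀ {x y z} → x ≤ y → y ≤ z → x ≤ z
  ≤-trans bot≤    _       = bot≤
  ≤-trans _       ≤top    = ≤top
  ≤-trans at≤mid  mid≤mid = at≤mid
  ≤-trans at≤at   y≤z     = y≤z
  ≤-trans mid≤mid y≤z     = y≤z

  ≤-antisym : ∀ {x y} → x ≤ y → y ≤ x → x ≡ y
  ≤-antisym bot≤    bot≤ = refl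
  ≤-antisym ≤top    ≤top = refl
  ≤-antisym mid≤mid _    = refl
  ≤-antisym at≤at   _    = refl

  ≡⇒≤ : ∀ {x y} → x ≡ y → x ≤ y
  ≡⇒≤ refl = ≤-refl

  top≰mid : ¬ top ≤ mid
  top≰mid ()

  a≢partner : ∀ a → a ≢ partner a
  a≢partner a a≡a′ = partner-≢ a (≡.sym a≡a′)

  ≢partner-sym : ∀ {a b} → b ≢ partner a → a ≢ partner b
  ≢partner-sym {a} {b} b≢a′ a≡b′ =
    b≢a′ (≡.trans (≡.sym (partner-involutive b)) (cong partner (≡.sym a≡b′)))

  at∧at-self : ∀ a → at a ∧ at a ≡ at a
  at∧at-self a with a ≟ a
  ... | yes _   = refl
  ... | no  a≢a = ⊥-elim (a≢a refl)

  at∧at-≢ : ∀ {a b} → a ≢ b → at a ∧ at b ≡ bot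
  at∧at-≢ {a} {b} a≢b with a ≟ b
  ... | yes a≡b = ⊥-elim (a≢b a≡b)
  ... | no  _   = refl

  at∨at-self : ∀ a → at a ∨ at a ≡ at a
  at∨at-self a with a ≟ a
  ... | yes _   = refl
  ... | no  a≢a = ⊥-elim (a≢a refl)

  at∨at-≢ : ∀ {a b} → a ≢ b → at a ∨ at b ≡ mid
  at∨at-≢ {a} {b} a≢b with a ≟ b
  ... | yes a≡b = ⊥-elim (a≢b a≡b)
  ... | no  _   = refl

  at∨at≤mid : ∀ a b → at a ∨ at b ≤ mid
  at∨at≤mid a b with a ≟ b
  ... | yes _ = at≤mid
  ... | no  _ = mid≤mid

  x∧y≤x : ∀ x y → x ∧ y ≤ x
  x∧y≤x bot    _      = bot≤
  x∧y≤x top    _      = ≤top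
  x∧y≤x mid    bot    = bot≤
  x∧y≤x mid    (at b) = at≤mid
  x∧y≤x mid    mid    = mid≤mid
  x∧y≤x mid    top    = mid≤mid
  x∧y≤x (at a) bot    = bot≤
  x∧y≤x (at a) (at b) with a ≟ b
  ... | yes _ = at≤at
  ... | no  _ = bot≤
  x∧y≤x (at a) mid    = at≤at
  x∧y≤x (at a) top    = at≤at

  x∧y≤y : ∀ x y → x ∧ y ≤ y
  x∧y≤y bot    _      = bot≤
  x∧y≤y top    _      = ≤-refl
  x∧y≤y mid    bot    = bot≤
  x∧y≤y mid    (at b) = at≤at
  x∧y≤y mid    mid    = mid≤mid
  x∧y≤y mid    top    = ≤top
  x∧y≤y (at a) bot    = bot≤
  x∧y≤y (at a) (at b) with a ≟ b
  ... | yes refl = at≤at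
  ... | no  _    = bot≤
  x∧y≤y (at a) mid    = at≤mid
  x∧y≤y (at a) top    = ≤top

  ∧-greatest : ∀ {x y z} → z ≤ x → z ≤ y → z ≤ x ∧ y
  ∧-greatest bot≤    _       = bot≤
  ∧-greatest ≤top    z≤y     = z≤y
  ∧-greatest at≤mid  ≤top    = at≤mid
  ∧-greatest at≤mid  at≤mid  = at≤mid
  ∧-greatest at≤mid  at≤at   = at≤at
  ∧-greatest mid≤mid ≤top    = mid≤mid
  ∧-greatest mid≤mid mid≤mid = mid≤mid
  ∧-greatest at≤at   ≤top    = at≤at
  ∧-greatest at≤at   at≤mid  = at≤at
  ∧-greatest (at≤at {a}) at≤at rewrite at∧at-self a = at≤at

  x≤x∨y : ∀ x y → x ≤ x ∨ y
  x≤x∨y bot    _      = bot≤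
  x≤x∨y top    _      = ≤top
  x≤x∨y mid    bot    = mid≤mid
  x≤x∨y mid    (at b) = mid≤mid
  x≤x∨y mid    mid    = mid≤mid
  x≤x∨y mid    top    = ≤top
  x≤x∨y (at a) bot    = at≤at
  x≤x∨y (at a) (at b) with a ≟ b
  ... | yes _ = at≤at
  ... | no  _ = at≤mid
  x≤x∨y (at a) mid    = at≤mid
  x≤x∨y (at a) top    = ≤top

  y≤x∨y : ∀ x y → y ≤ x ∨ y
  y≤x∨y bot    _      = ≤-refl
  y≤x∨y top    _      = ≤top
  y≤x∨y mid    bot    = bot≤
  y≤x∨y mid    (at b) = at≤mid
  y≤x∨y mid    mid    = mid≤mid
  y≤x∨y mid    top    = ≤top
  y≤x∨y (at a) bot    = bot≤
  y≤x∨y (at a) (at b) with a ≟ b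
  ... | yes refl = at≤at
  ... | no  _    = at≤mid
  y≤x∨y (at a) mid    = mid≤mid
  y≤x∨y (at a) top    = ≤top

  ∨-least : ∀ {x y z} → x ≤ z → y ≤ z → x ∨ y ≤ z
  ∨-least bot≤    y≤z     = y≤z
  ∨-least ≤top    _       = ≤top
  ∨-least at≤mid  bot≤    = at≤mid
  ∨-least (at≤mid {a}) (at≤mid {b}) = at∨at≤mid a b
  ∨-least at≤mid  mid≤mid = mid≤mid
  ∨-least mid≤mid bot≤    = mid≤mid
  ∨-least mid≤mid at≤mid  = mid≤mid
  ∨-least mid≤mid mid≤mid = mid≤mid
  ∨-least at≤at   bot≤    = at≤at
  ∨-least (at≤at {a}) at≤at rewrite at∨at-self a = at≤at

  antitone : ∀ {x y} → x ≤ y → ~ y ≤ ~ x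
  antitone bot≤    = ≤top
  antitone ≤top    = bot≤
  antitone at≤mid  = bot≤
  antitone mid≤mid = ≤-refl
  antitone at≤at   = at≤at

  x∧~x≡bot : ∀ x → x ∧ ~ x ≡ bot
  x∧~x≡bot bot    = refl
  x∧~x≡bot (at a) = at∧at-≢ (a≢partner a)
  x∧~x≡bot mid    = refl
  x∧~x≡bot top    = refl

  ~~at : ∀ a → ~ ~ at a ≡ at a
  ~~at a = cong at (partner-involutive a)

  x≤~~x : ∀ x → x ≤ ~ ~ x
  x≤~~x bot    = bot≤
  x≤~~x (at a) = ≡⇒≤ (≡.sym (~~at a))
  x≤~~x mid    = ≤top
  x≤~~x top    = ≤top

  boundedLattice : BoundedLattice 0ℓ 0ℓ 0ℓ
  boundedLattice = record
    { Carrier = K ; _≈_ = _≡_ ; _≤_ = _≤_ ; _∨_ = _∨_ ; _∧_ = _∧_ ; ⊤ = top ; ⊥ = bot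
    ; isBoundedLattice = record
      { isLattice = record
        { isPartialOrder = record
          { isPreorder = record
            { isEquivalence = isEquivalence ; reflexive = ≡⇒≤ ; trans = ≤-trans }
          ; antisym = ≤-antisym }
        ; supremum = λ x y → x≤x∨y x y , y≤x∨y x y , λ _ → ∨-least
        ; infimum  = λ x y → x∧y≤x x y , x∧y≤y x y , λ _ → ∧-greatest }
      ; maximum = λ _ → ≤top
      ; minimum = λ _ → bot≤ } }

  fundLattice : FundLattice
  fundLattice = record
    { lat = boundedLattice ; ¬_ = ~_ ; antitone = antitone ; contra = x∧~x≡bot ; dneg = x≤~~x }

  ⟦_⟧ᴷ : Fm → (ℕ → K) → K
  ⟦_⟧ᴷ = ⟦_⟧ fundLattice

  ~~x≤x⊎mid≤x : ∀ x → ~ ~ x ≤ x ⊎ mid ≤ x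
  ~~x≤x⊎mid≤x bot    = inj₁ bot≤
  ~~x≤x⊎mid≤x (at a) = inj₁ (≡⇒≤ (~~at a))
  ~~x≤x⊎mid≤x mid    = inj₂ mid≤mid
  ~~x≤x⊎mid≤x top    = inj₂ ≤top

  x≤mid⊎x≡top : ∀ x → x ≤ mid ⊎ x ≡ top
  x≤mid⊎x≡top bot    = inj₁ bot≤
  x≤mid⊎x≡top (at a) = inj₁ at≤mid
  x≤mid⊎x≡top mid    = inj₁ mid≤mid
  x≤mid⊎x≡top top    = inj₂ refl

  z≤x∨y∨z : ∀ x y z → z ≤ x ∨ y ∨ z
  z≤x∨y∨z x y z = ≤-trans (y≤x∨y y z) (y≤x∨y x _)

  -- Either ¬¬f ≤ f, or mid ≤ f and then a ≤ f unless a = ⊤.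
  Vi-holds : ∀ a c e f → a ∧ (c ∨ e) ∧ ~ ~ f ≤ (a ∧ c) ∨ (a ∧ e) ∨ f
  Vi-holds a c e f with ~~x≤x⊎mid≤x f | x≤mid⊎x≡top a
  ... | inj₁ ~~f≤f | _ =
    ≤-trans (≤-trans (x∧y≤y a _) (x∧y≤y (c ∨ e) _)) (≤-trans ~~f≤f (z≤x∨y∨z (a ∧ c) (a ∧ e) f))
  ... | inj₂ mid≤f | inj₁ a≤mid =
    ≤-trans (x∧y≤x a _) (≤-trans (≤-trans a≤mid mid≤f) (z≤x∨y∨z (a ∧ c) (a ∧ e) f))
  ... | inj₂ _ | inj₂ refl =
    ≤-trans (x∧y≤x (c ∨ e) _) (∨-least (x≤x∨y c _) (≤-trans (x≤x∨y e f) (y≤x∨y c _)))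

  ~~-∧ : ∀ p q → ~ ~ p ∧ ~ ~ q ≤ ~ ~ (p ∧ q)
  ~~-∧ bot    _      = bot≤
  ~~-∧ top    _      = ≤-refl
  ~~-∧ mid    bot    = bot≤
  ~~-∧ mid    (at b) = ≤-refl
  ~~-∧ mid    mid    = ≤-refl
  ~~-∧ mid    top    = ≤-refl
  ~~-∧ (at a) bot    = bot≤
  ~~-∧ (at a) (at b) rewrite partner-involutive a | partner-involutive b = x≤~~x (at a ∧ at b)
  ~~-∧ (at a) mid    = ≤-refl
  ~~-∧ (at a) top    = ≤-refl

  valid-Vi : Valid fundLattice Vi
  valid-Vi v = Vi-holds (v 0) (v 2) (v 4) (v 5)

  valid-Nu : Valid fundLattice Nu
  valid-Nu v = ~~-∧ (v 0) (v 1)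

  IsAtom : K → Set
  IsAtom x = Σ A λ a → x ≡ at a

  isAtom? : ∀ x → Dec (IsAtom x)
  isAtom? bot    = no λ ()
  isAtom? (at a) = yes (a , refl)
  isAtom? mid    = no λ ()
  isAtom? top    = no λ ()

  wem-nonatom : ∀ φ v → ¬ IsAtom (⟦ φ ⟧ᴷ v) → ⟦ wem φ ⟧ᴷ v ≡ top
  wem-nonatom φ v ¬atom with ⟦ φ ⟧ᴷ v
  ... | bot  = refl
  ... | at a = ⊥-elim (¬atom (a , refl))
  ... | mid  = refl
  ... | top  = refl

  wem-atom : ∀ φ v {a} → ⟦ φ ⟧ᴷ v ≡ at a → ⟦ wem φ ⟧ᴷ v ≤ mid
  wem-atom φ v {a} φ≡a rewrite φ≡a = at∨at≤mid (partner a) (partner (partner a))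

  paired-partners : ∀ φ ψ v {a b} → ⟦ φ ⟧ᴷ v ≡ at a → ⟦ ψ ⟧ᴷ v ≡ at b →
                    b ≡ a ⊎ b ≡ partner a → ⟦ paired φ ψ ⟧ᴷ v ≡ top
  paired-partners φ ψ v {a} φ≡a ψ≡a (inj₁ refl)
    rewrite φ≡a | ψ≡a | at∨at-≢ (a≢partner a) | at∨at-self a | at∧at-≢ (partner-≢ a) = refl
  paired-partners φ ψ v {a} φ≡a ψ≡a′ (inj₂ refl)
    rewrite φ≡a | ψ≡a′ | partner-involutive a | at∨at-self a | at∨at-≢ (a≢partner a)
          | at∧at-≢ (a≢partner a) = refl

  paired-strangers : ∀ φ ψ v {a b} → ⟦ φ ⟧ᴷ v ≡ at a → ⟦ ψ ⟧ᴷ v ≡ at b →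
                     b ≢ a → b ≢ partner a → ⟦ paired φ ψ ⟧ᴷ v ≤ mid
  paired-strangers φ ψ v {a} {b} φ≡a ψ≡b b≢a b≢a′
    rewrite φ≡a | ψ≡b | at∨at-≢ (≢partner-sym b≢a′) | at∨at-≢ (≢-sym b≢a) = at≤mid

Atom : ℕ → Set
Atom P = Fin P × Bool

flip : ∀ {P} → Atom P → Atom P
flip = map₂ not

flip-involutive : ∀ {P} (a : Atom P) → flip (flip a) ≡ a
flip-involutive (k , s) = cong (k ,_) (Bool.not-involutive s)

flip-≢ : ∀ {P} (a : Atom P) → flip a ≢ a
flip-≢ (k , s) flip-a≡a = Bool.not-¬ refl (≡.sym (cong proj₂ flip-a≡a))

same-index : ∀ {P} (a b : Atom P) → proj₁ a ≡ proj₁ b → b ≡ a ⊎ b ≡ flip a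
same-index (k , true)  (.k , true)  refl = inj₁ refl
same-index (k , true)  (.k , false) refl = inj₂ refl
same-index (k , false) (.k , true)  refl = inj₂ refl
same-index (k , false) (.k , false) refl = inj₁ refl

module Pairs (P : ℕ) =
  AtomLattice {Atom P} (≡-dec Fin._≟_ Bool._≟_) flip (flip-involutive {P}) (flip-≢ {P})

𝕂 : ℕ → FundLattice
𝕂 P = Pairs.fundLattice P

mod-injective : ∀ {i l n} .{{_ : ℕ.NonZero n}} → i ℕ.< n → l ℕ.< n → i mod n ≡ l mod n → i ≡ l
mod-injective {i} {l} {n} i<n l<n i≡l-mod = begin
  i             ≡⟨ m<n⇒m%n≡m i<n ⟨
  i % n         ≡⟨ toℕ-fromℕ< _ ⟨
  toℕ (i mod n) ≡⟨ cong toℕ i≡l-mod ⟩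
  toℕ (l mod n) ≡⟨ toℕ-fromℕ< _ ⟩
  l % n         ≡⟨ m<n⇒m%n≡m l<n ⟩
  l             ∎
  where open ≡-Reasoning

module _ {P : ℕ} where
  open Pairs P

  php-⊤ : ∀ {N} → P ℕ.< N → ∀ v → top ≤ ⟦ php N ⟧ᴷ v
  php-⊤ {N} P<N v with all? (λ k → isAtom? (⟦ pigeon (toℕ k) ⟧ᴷ v))
  ... | no ¬all =
    let k , ¬atom = ¬∀⟶∃¬ N _ (λ k → isAtom? _) ¬all in
    ≤-trans (≡⇒≤ (≡.sym (wem-nonatom (pigeon (toℕ k)) v ¬atom))) (wem≤php (𝕂 P) v (toℕ<n k))
  ... | yes atoms =
    let k₁ , k₂ , k₁<k₂ , same-pair = pigeonhole P<N (λ k → proj₁ (proj₁ (atoms k)))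
        a₁ , v-k₁≡a₁ = atoms k₁
        a₂ , v-k₂≡a₂ = atoms k₂
        pigeons-paired = paired-partners (pigeon (toℕ k₂)) (pigeon (toℕ k₁)) v v-k₂≡a₂ v-k₁≡a₁
                                         (same-index a₂ a₁ (≡.sym same-pair))
    in ≤-trans (≡⇒≤ (≡.sym pigeons-paired)) (paired≤php (𝕂 P) v k₁<k₂ (toℕ<n k₂))

  Ex-php-holds : ∀ {N} → P ℕ.< N → Valid (𝕂 P) (Ex-php N)
  Ex-php-holds P<N v =
    ≤-trans ≤top (≤-trans (php-⊤ P<N v) (y≤x∨y (⟦ Entailment.rhs Ex ⟧ᴷ v) _))

module _ (k : ℕ) where
  open Pairs (2 + k)

  -- The premise of Ex evaluates to ⊤ and its conclusion to mid; d must be an atom outside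
  -- the pair of b, so at least two pairs are needed.
  counterexample : ℕ → K
  counterexample = assign top (at (Fin.zero , false)) (at (Fin.zero , true))
                          (at (Fin.suc Fin.zero , false)) top top
                          λ i → at (i mod (2 + k) , false)

  php≤mid : ∀ {N} → N ℕ.≤ 2 + k → ⟦ php N ⟧ᴷ counterexample ≤ mid
  php≤mid N≤P = php-least (𝕂 (2 + k)) counterexample
    (λ i _ → wem-atom (pigeon i) counterexample refl)
    (λ i l l<i i<N → paired-strangers (pigeon i) (pigeon l) counterexample refl refl
       (λ l≡i → <⇒≢ l<i (mod-injective (<-trans l<i (<-≤-trans i<N N≤P)) (<-≤-trans i<N N≤P)
                                       (cong proj₁ l≡i)))
       λ ())

  Ex-php-fails : ∀ {N} → N ℕ.≤ 2 + k → ¬ Valid (𝕂 (2 + k)) (Ex-php N)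
  Ex-php-fails N≤P valid =
    top≰mid (≤-trans (valid counterexample) (∨-least ≤-refl (php≤mid N≤P)))

data Axioms (n : ℕ) : Entailment → Set where
  inherit : ∀ {g} → ViNu g → Axioms n g
  ex-php  : Axioms n (Ex-php (3 + n))

Ex⇒Axioms : ∀ L {n g} → Valid L Ex → Axioms n g → Valid L g
Ex⇒Axioms L ⊨Ex (inherit vi) = Ex⇒Vi L ⊨Ex
Ex⇒Axioms L ⊨Ex (inherit nu) = Ex⇒Nu L ⊨Ex
Ex⇒Axioms L {n} ⊨Ex ex-php   = Ex⇒Ex-php L ⊨Ex (3 + n)

𝕂-validates-Axioms : ∀ n g → Axioms n g → Valid (𝕂 (2 + n)) g
𝕂-validates-Axioms n _ (inherit vi) = Pairs.valid-Vi (2 + n)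
𝕂-validates-Axioms n _ (inherit nu) = Pairs.valid-Nu (2 + n)
𝕂-validates-Axioms n _ ex-php       = Ex-php-holds (n<1+n (2 + n))

FL+Axioms-⊈ : ∀ {j k} → j ℕ.< k → ¬ (FL+ (Axioms j) ⊆E FL+ (Axioms k))
FL+Axioms-⊈ {j} {k} j<k FLj⊆FLk =
  Ex-php-fails k (s≤s (s≤s j<k))
    (FLj⊆FLk (Ex-php (3 + j)) (FL+-axiom ex-php) (𝕂 (2 + k)) (𝕂-validates-Axioms k))

corollary7p2 : Σ (ℕ → Entailment → Set) λ Γ →
    (∀ n → (FL+ ViNu ⊆E FL+ (Γ n)) × (FL+ (Γ n) ⊆E FL+ ExAx))
    × (∀ m n → m ≢ n → ¬ (FL+ (Γ m) ≐E FL+ (Γ n)))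
corollary7p2 = Axioms , (λ n → ViNu⊆ , Axioms⊆Ex) , distinct
  where
  ViNu⊆ : ∀ {n} → FL+ ViNu ⊆E FL+ (Axioms n)
  ViNu⊆ = FL+-⊆ λ _ γ → FL+-axiom (inherit γ)

  Axioms⊆Ex : ∀ {n} → FL+ (Axioms n) ⊆E FL+ ExAx
  Axioms⊆Ex = FL+-⊆ λ _ ax L ⊨ExAx → Ex⇒Axioms L (⊨ExAx Ex ex) ax

  distinct : ∀ m n → m ≢ n → ¬ (FL+ (Axioms m) ≐E FL+ (Axioms n))
  distinct m n m≢n (m⊆n , n⊆m) with <-cmp m n
  ... | tri< m<n _ _ = FL+Axioms-⊈ m<n m⊆n
  ... | tri≈ _ m≡n _ = m≢n m≡n
  ... | tri> _ _ n<m = FL+Axioms-⊈ n<m n⊆m
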